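{- Let $\Gamma$ and $\Delta$ be simplicial complexes on disjoint vertex sets. Then the join $\Gamma*\Delta=\{F\sqcup G\mid F\in\Gamma,\ G\in\Delta\}$ is strongly shellable if and only if both $\Gamma$ and $\Delta$ are strongly shellable.
   Context: A simplicial complex is a finite family of subsets of a vertex set closed under taking subsets; $\mathcal{F}(\Delta)$ is its set of facets. A linear order $F_1,\dots,F_t$ of $\mathcal{F}(\Delta)$ is a strong shelling order if for every $1\le i<j\le t$ there exists $k$ with $1\le k<j$ such that $|F_j\setminus F_k|=1$, $F_j\setminus F_k\subseteq F_j\setminus F_i$, and $F_k\setminus F_j\subseteq F_i$; $\Delta$ is strongly shellable if such an order exists. -}

module Defs where

open import Data.Nat using (ℕ; _+_)
open import Data.Fin using (Fin; _<_)
open import Data.Fin.Subset using (Subset; _⊆_; _─_; ∣_∣; ⊥)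
open import Data.Vec using (_++_)
open import Data.Product using (Σ; ∃; ∃-syntax; _×_)
open import Function.Definitions using (Injective)
open import Relation.Binary.PropositionalEquality using (_≡_)

-- A complex on the vertex set Fin n is a predicate on subsets of Fin n
-- (it is automatically finite).
Complex : ℕ → Set₁
Complex n = Subset n → Set

IsSimplicialComplex : {n : ℕ} → Complex n → Set
IsSimplicialComplex {n} C =
  C ⊥ × (∀ (F G : Subset n) → G ⊆ F → C F → C G)

IsFacet : {n : ℕ} → Complex n → Subset n → Set
IsFacet {n} C F = C F × (∀ (G : Subset n) → C G → F ⊆ G → G ≡ F)

IsStrongShellingOrder : {n : ℕ} → Complex n → (t : ℕ) → (Fin t → Subset n) → Set
IsStrongShellingOrder {n} C t σ =
  Injective _≡_ _≡_ σ
  × (∀ i → IsFacet C (σ i))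
  × (∀ (F : Subset n) → IsFacet C F → ∃[ i ] σ i ≡ F)
  × (∀ (i j : Fin t) → i < j →
       ∃[ k ] (k < j
               × ∣ σ j ─ σ k ∣ ≡ 1
               × (σ j ─ σ k) ⊆ (σ j ─ σ i)
               × (σ k ─ σ j) ⊆ σ i))

StronglyShellable : {n : ℕ} → Complex n → Set
StronglyShellable {n} C = ∃[ t ] Σ (Fin t → Subset n) (IsStrongShellingOrder C t)

-- Join of complexes on the disjoint vertex sets Fin m and Fin n,
-- realised on Fin (m + n) (first m vertices from Γ, last n from Δ).
Join : {m n : ℕ} → Complex m → Complex n → Complex (m + n)
Join {m} {n} Γ Δ H =
  ∃[ F ] ∃[ G ] (Γ F × Δ G × H ≡ F ++ G)

-- A facet of Γ * Δ is F ++ G with F and G facets, and for facets of this form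
-- the strong shelling condition splits componentwise: the witness F_k ++ G_k
-- exchanges a single vertex in one of the two components, each component moves
-- towards that of F_i ++ G_i, and a component in which F_i ++ G_i and
-- F_j ++ G_j agree is left unchanged.  Hence the lexicographic product of
-- shellings of Γ and Δ shells Γ * Δ; conversely, for a shelling of Γ * Δ and a
-- facet G₀ of Δ, the subsequence of the facets F ++ G₀ is a shelling of Γ.
module Submission where

open import Defs
open import Data.Nat as ℕ using (ℕ; zero; suc; _+_; _*_; _≤_; s≤s; z≤n)
open import Data.Nat.Properties
  using (+-comm; +-identityʳ; +-suc; +-cancelˡ-<; +-monoʳ-<; +-monoˡ-≤; ≤-trans; ≤-reflexive; <⇒≱; m≤n+m)
open import Data.Fin using (Fin; zero; suc; _<_; toℕ; combine; remQuot)
open import Data.Fin.Properties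
  using (¬Fin0; <-cmp; <-asym; <-irrefl; <⇒≢; toℕ-combine; combine-monoˡ-<; combine-surjective;
         remQuot-combine; *↔×)
open import Data.Fin.Subset using (Subset; inside; outside; _∈_; _⊆_; _⊂_; _─_; ∣_∣; ⊥)
open import Data.Fin.Subset.Properties
  using (_∈?_; _⊂?_; ⊆-refl; ⊆-antisym; ⊥⊆; ∉⊥; ∣⊥∣≡0; ∣p∣≤n; drop-∷-⊆; out⊆; s⊆s;
         p⊂q⇒∣p∣<∣q∣; x∈p∧x∉q⇒x∈p─q)
open import Data.Vec using (Vec; []; _∷_; _++_; take; drop; here)
open import Data.Vec.Properties using (≡-dec; ++-injective; ++-injectiveˡ; ++-injectiveʳ; take++drop≡id; zipWith-++)
open import Data.Product as Product using (Σ; ∃; ∃-syntax; _×_; _,_; proj₁; proj₂; uncurry; swap)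
open import Data.Bool.Properties as Bool using ()
open import Data.Product.Algebra using (×-comm)
open import Data.Sum using (_⊎_; inj₁; inj₂)
open import Data.Empty using (⊥-elim)
open import Function using (_∘_; id)
open import Function.Bundles using (_⇔_; mk⇔; _↔_; mk↔ₛ′; Inverse; Injection; Equivalence)
open import Function.Definitions using (Injective)
open import Function.Properties.Inverse using (Inverse⇒Injection; ↔-sym)
open import Relation.Binary.Definitions using (tri<; tri≈; tri>)
open import Relation.Binary.PropositionalEquality using (_≡_; refl; sym; trans; cong; cong₂; subst; subst₂)
open import Relation.Nullary using (¬_; yes; no; contradiction)
open import Relation.Unary using (Decidable)

private
  variable
    m n t : ℕ

module _ {A : Set} (Facet : A → Set) (Step : A → A → A → Set) where

  IsShellingOrder : (t : ℕ) → (Fin t → A) → Set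
  IsShellingOrder t σ =
    Injective _≡_ _≡_ σ
    × (∀ i → Facet (σ i))
    × (∀ F → Facet F → ∃[ i ] σ i ≡ F)
    × (∀ (i j : Fin t) → i < j → ∃[ k ] (k < j × Step (σ i) (σ j) (σ k)))

  Shellable : Set
  Shellable = ∃[ t ] Σ (Fin t → A) (IsShellingOrder t)

open Inverse using (to; from; strictlyInverseˡ)

shellable-map : {A B : Set} {FacetA : A → Set} {StepA : A → A → A → Set}
                {FacetB : B → Set} {StepB : B → B → B → Set} (e : A ↔ B) →
                (∀ a → FacetA a → FacetB (to e a)) → (∀ b → FacetB b → FacetA (from e b)) →
                (∀ x y z → StepA x y z → StepB (to e x) (to e y) (to e z)) →
                Shellable FacetA StepA → Shellable FacetB StepB
shellable-map {FacetB = FacetB} e facet-to facet-from step-to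
              (t , σ , σ-injective , σ-facet , σ-onto , σ-step) =
  t , to e ∘ σ , σ-injective ∘ Injection.injective (Inverse⇒Injection e) ,
  (λ i → facet-to (σ i) (σ-facet i)) , onto ,
  λ i j i<j → let k , k<j , step = σ-step i j i<j in k , k<j , step-to _ _ _ step
  where
  onto : ∀ b → FacetB b → ∃[ i ] to e (σ i) ≡ b
  onto b b-facet =
    let i , σi≡ = σ-onto (from e b) (facet-from b b-facet)
    in i , trans (cong (to e) σi≡) (strictlyInverseˡ e b)

shellable-↔ : {A B : Set} {FacetA : A → Set} {StepA : A → A → A → Set}
              {FacetB : B → Set} {StepB : B → B → B → Set} (e : A ↔ B) →
              (∀ a → FacetA a ⇔ FacetB (to e a)) →
              (∀ x y z → StepA x y z ⇔ StepB (to e x) (to e y) (to e z)) →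
              Shellable FacetA StepA ⇔ Shellable FacetB StepB
shellable-↔ {FacetA = FacetA} {StepA = StepA} {FacetB = FacetB} {StepB = StepB} e facet⇔ step⇔ = mk⇔
  (shellable-map {StepA = StepA} {StepB = StepB} e
     (λ a → Equivalence.to (facet⇔ a)) facet-from (λ x y z → Equivalence.to (step⇔ x y z)))
  (shellable-map {StepA = StepB} {StepB = StepA} (↔-sym e)
     facet-from (λ a → Equivalence.to (facet⇔ a)) step-from)
  where
  facet-from : ∀ b → FacetB b → FacetA (from e b)
  facet-from b = Equivalence.from (facet⇔ (from e b)) ∘ subst FacetB (sym (strictlyInverseˡ e b))

  step-from : ∀ x y z → StepB x y z → StepA (from e x) (from e y) (from e z)
  step-from x y z = Equivalence.from (step⇔ (from e x) (from e y) (from e z)) ∘ back-to-from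
    where
    back-to-from : StepB x y z → StepB (to e (from e x)) (to e (from e y)) (to e (from e z))
    back-to-from rewrite strictlyInverseˡ e x | strictlyInverseˡ e y | strictlyInverseˡ e z = id

-- IsStrongShellingOrder C is IsShellingOrder (IsFacet C) StrongShellingStep by definition.

StepsToward : Subset n → Subset n → Subset n → Set
StepsToward Fi Fj Fk = (Fj ─ Fk) ⊆ (Fj ─ Fi) × (Fk ─ Fj) ⊆ Fi

StrongShellingStep : Subset n → Subset n → Subset n → Set
StrongShellingStep Fi Fj Fk = ∣ Fj ─ Fk ∣ ≡ 1 × StepsToward Fi Fj Fk

PairStep : (Fi Fj Fk : Subset m × Subset n) → Set
PairStep (Fi , Gi) (Fj , Gj) (Fk , Gk) =
  ∣ Fj ─ Fk ∣ + ∣ Gj ─ Gk ∣ ≡ 1 × StepsToward Fi Fj Fk × StepsToward Gi Gj Gk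

FacetPair : Complex m → Complex n → Subset m × Subset n → Set
FacetPair Γ Δ (F , G) = IsFacet Γ F × IsFacet Δ G

×↔++ : ∀ {A : Set} → (Vec A m × Vec A n) ↔ Vec A (m + n)
×↔++ {m} = mk↔ₛ′ (uncurry _++_) (λ v → take m v , drop m v) (take++drop≡id m)
  (λ (u , v) → uncurry (cong₂ _,_) (++-injective (take m (u ++ v)) u (take++drop≡id m (u ++ v))))

∣p++q∣≡∣p∣+∣q∣ : (p : Subset m) (q : Subset n) → ∣ p ++ q ∣ ≡ ∣ p ∣ + ∣ q ∣
∣p++q∣≡∣p∣+∣q∣ []            q = refl
∣p++q∣≡∣p∣+∣q∣ (inside ∷ p)  q = cong suc (∣p++q∣≡∣p∣+∣q∣ p q)
∣p++q∣≡∣p∣+∣q∣ (outside ∷ p) q = ∣p++q∣≡∣p∣+∣q∣ p q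

p++q─p′++q′≡p─p′++q─q′ : (p p′ : Subset m) (q q′ : Subset n) → (p ++ q) ─ (p′ ++ q′) ≡ (p ─ p′) ++ (q ─ q′)
p++q─p′++q′≡p─p′++q─q′ p p′ q q′ = zipWith-++ _ p q p′ q′

++-⊆⁺ : {p p′ : Subset m} {q q′ : Subset n} → p ⊆ p′ → q ⊆ q′ → p ++ q ⊆ p′ ++ q′
++-⊆⁺ {p = []}          {[]}           _    q⊆q′ = q⊆q′
++-⊆⁺ {p = outside ∷ p} {_ ∷ p′}       p⊆p′ q⊆q′ = out⊆ (++-⊆⁺ (drop-∷-⊆ p⊆p′) q⊆q′)
++-⊆⁺ {p = inside ∷ p}  {inside ∷ p′}  p⊆p′ q⊆q′ = s⊆s (++-⊆⁺ (drop-∷-⊆ p⊆p′) q⊆q′)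
++-⊆⁺ {p = inside ∷ p}  {outside ∷ p′} p⊆p′ _    = contradiction (p⊆p′ here) λ ()

++-⊆⁻ : {p p′ : Subset m} {q q′ : Subset n} → p ++ q ⊆ p′ ++ q′ → p ⊆ p′ × q ⊆ q′
++-⊆⁻ {p = []}          {[]}           h = (λ ()) , h
++-⊆⁻ {p = outside ∷ p} {_ ∷ p′}       h = Product.map₁ out⊆ (++-⊆⁻ (drop-∷-⊆ h))
++-⊆⁻ {p = inside ∷ p}  {inside ∷ p′}  h = Product.map₁ s⊆s (++-⊆⁻ (drop-∷-⊆ h))
++-⊆⁻ {p = inside ∷ p}  {outside ∷ p′} h = contradiction (h here) λ ()

p─p≡⊥ : (p : Subset n) → p ─ p ≡ ⊥
p─p≡⊥ []            = refl
p─p≡⊥ (inside ∷ p)  = cong (outside ∷_) (p─p≡⊥ p)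
p─p≡⊥ (outside ∷ p) = cong (outside ∷_) (p─p≡⊥ p)

∣p─p∣≡0 : (p : Subset n) → ∣ p ─ p ∣ ≡ 0
∣p─p∣≡0 {n} p = trans (cong ∣_∣ (p─p≡⊥ p)) (∣⊥∣≡0 n)

p─p⊆q : (p q : Subset n) → p ─ p ⊆ q
p─p⊆q p q = ⊥⊆ ∘ subst (_ ∈_) (p─p≡⊥ p)

stepsToward-refl : (F G : Subset n) → StepsToward F G G
stepsToward-refl F G = p─p⊆q G (G ─ F) , p─p⊆q G F

stepsToward-self : {G G′ : Subset n} → StepsToward G G G′ → G′ ≡ G
stepsToward-self {G = G} {G′} (G─G′⊆∅ , G′─G⊆G) = ⊆-antisym G′⊆G G⊆G′
  where
  G′⊆G : G′ ⊆ G
  G′⊆G {x} x∈G′ with x ∈? G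
  ... | yes x∈G = x∈G
  ... | no  x∉G = contradiction (G′─G⊆G (x∈p∧x∉q⇒x∈p─q x∈G′ x∉G)) x∉G

  G⊆G′ : G ⊆ G′
  G⊆G′ {x} x∈G with x ∈? G′
  ... | yes x∈G′ = x∈G′
  ... | no  x∉G′ = ⊥-elim (∉⊥ (subst (x ∈_) (p─p≡⊥ G) (G─G′⊆∅ (x∈p∧x∉q⇒x∈p─q x∈G x∉G′))))

stepsToward-++ : {Fi Fj Fk : Subset m} {Gi Gj Gk : Subset n} →
                 StepsToward (Fi ++ Gi) (Fj ++ Gj) (Fk ++ Gk) ⇔ (StepsToward Fi Fj Fk × StepsToward Gi Gj Gk)
stepsToward-++ {Fi = Fi} {Fj} {Fk} {Gi} {Gj} {Gk}
  rewrite p++q─p′++q′≡p─p′++q─q′ Fj Fk Gj Gk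
        | p++q─p′++q′≡p─p′++q─q′ Fj Fi Gj Gi
        | p++q─p′++q′≡p─p′++q─q′ Fk Fj Gk Gj = mk⇔
  (λ (removed , added) → let rF , rG = ++-⊆⁻ removed ; aF , aG = ++-⊆⁻ added in (rF , aF) , (rG , aG))
  (λ ((rF , aF) , (rG , aG)) → ++-⊆⁺ rF rG , ++-⊆⁺ aF aG)

pairStep⇔strongShellingStep-++ : {Fi Fj Fk : Subset m} {Gi Gj Gk : Subset n} →
  PairStep (Fi , Gi) (Fj , Gj) (Fk , Gk) ⇔ StrongShellingStep (Fi ++ Gi) (Fj ++ Gj) (Fk ++ Gk)
pairStep⇔strongShellingStep-++ {Fj = Fj} {Fk} {Gj = Gj} {Gk} = mk⇔
  (λ (size≡1 , toward) → trans size-++ size≡1 , Equivalence.from stepsToward-++ toward)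
  (λ (size≡1 , toward) → trans (sym size-++) size≡1 , Equivalence.to stepsToward-++ toward)
  where
  size-++ : ∣ (Fj ++ Gj) ─ (Fk ++ Gk) ∣ ≡ ∣ Fj ─ Fk ∣ + ∣ Gj ─ Gk ∣
  size-++ = trans (cong ∣_∣ (p++q─p′++q′≡p─p′++q─q′ Fj Fk Gj Gk)) (∣p++q∣≡∣p∣+∣q∣ (Fj ─ Fk) (Gj ─ Gk))

pairStep-left : {Fi Fj Fk : Subset m} (Gi G : Subset n) →
                StrongShellingStep Fi Fj Fk → PairStep (Fi , Gi) (Fj , G) (Fk , G)
pairStep-left {Fj = Fj} {Fk} Gi G (size≡1 , toward) =
  trans (cong (∣ Fj ─ Fk ∣ +_) (∣p─p∣≡0 G)) (trans (+-identityʳ _) size≡1) , toward , stepsToward-refl Gi G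

pairStep-right : (Fi F : Subset m) {Gi Gj Gk : Subset n} →
                 StrongShellingStep Gi Gj Gk → PairStep (Fi , Gi) (F , Gj) (F , Gk)
pairStep-right Fi F (size≡1 , toward) =
  trans (cong (_+ _) (∣p─p∣≡0 F)) size≡1 , stepsToward-refl Fi F , toward

pairStep-fiber : {Fi Fj Fk : Subset m} {Gi Gj Gk G : Subset n} → Gi ≡ G → Gj ≡ G →
                 PairStep (Fi , Gi) (Fj , Gj) (Fk , Gk) → Gk ≡ G × StrongShellingStep Fi Fj Fk
pairStep-fiber {Fj = Fj} {Fk} {G = G} refl refl (size≡1 , towardF , towardG)
  with refl ← stepsToward-self towardG =
  refl , trans (sym (+-identityʳ _)) (subst (λ d → ∣ Fj ─ Fk ∣ + d ≡ 1) (∣p─p∣≡0 G) size≡1) , towardF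

pairStep-swap : {Fi Fj Fk : Subset m × Subset n} → PairStep Fi Fj Fk → PairStep (swap Fi) (swap Fj) (swap Fk)
pairStep-swap {Fj = Fj , Gj} {Fk , Gk} (size≡1 , towardF , towardG) =
  trans (+-comm ∣ Gj ─ Gk ∣ ∣ Fj ─ Fk ∣) size≡1 , towardG , towardF

module _ {Γ : Complex m} {Δ : Complex n} where

  isFacet-join⁺ : {F : Subset m} {G : Subset n} → IsFacet Γ F → IsFacet Δ G → IsFacet (Join Γ Δ) (F ++ G)
  isFacet-join⁺ {F} {G} (F∈Γ , F-maximal) (G∈Δ , G-maximal) = (F , G , F∈Γ , G∈Δ , refl) , maximal
    where
    maximal : ∀ H → Join Γ Δ H → F ++ G ⊆ H → H ≡ F ++ G
    maximal _ (F′ , G′ , F′∈Γ , G′∈Δ , refl) F++G⊆F′++G′ =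
      let F⊆F′ , G⊆G′ = ++-⊆⁻ F++G⊆F′++G′
      in cong₂ _++_ (F-maximal F′ F′∈Γ F⊆F′) (G-maximal G′ G′∈Δ G⊆G′)

  isFacet-join⁻ : {F : Subset m} {G : Subset n} → IsFacet (Join Γ Δ) (F ++ G) → IsFacet Γ F × IsFacet Δ G
  isFacet-join⁻ {F} {G} ((F′ , G′ , F′∈Γ , G′∈Δ , F++G≡F′++G′) , maximal)
    with refl , refl ← ++-injective F F′ F++G≡F′++G′ =
    (F′∈Γ , λ K K∈Γ F⊆K →
       ++-injectiveˡ K F (maximal (K ++ G) (K , G , K∈Γ , G′∈Δ , refl) (++-⊆⁺ F⊆K ⊆-refl))) ,
    (G′∈Δ , λ K K∈Δ G⊆K →
       ++-injectiveʳ F F (maximal (F ++ K) (F , K , F′∈Γ , K∈Δ , refl) (++-⊆⁺ ⊆-refl G⊆K)))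

  shellable-join : Shellable (FacetPair Γ Δ) PairStep ⇔ StronglyShellable (Join Γ Δ)
  shellable-join = shellable-↔ {StepA = PairStep} {StepB = StrongShellingStep} ×↔++
    (λ _ → mk⇔ (uncurry isFacet-join⁺) isFacet-join⁻)
    (λ _ _ _ → pairStep⇔strongShellingStep-++)

shellable-swap : {Γ : Complex m} {Δ : Complex n} →
                 Shellable (FacetPair Γ Δ) PairStep → Shellable (FacetPair Δ Γ) PairStep
shellable-swap = shellable-map {StepA = PairStep} {StepB = PairStep} (×-comm _ _)
  (λ _ → swap) (λ _ → swap) (λ _ _ _ → pairStep-swap)

record Enumeration {t : ℕ} (P : Fin t → Set) : Set where
  field
    size         : ℕ
    index        : Fin size → Fin t
    index-mono-< : ∀ {a b} → a < b → index a < index b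
    index-∈      : ∀ a → P (index a)
    index-onto   : ∀ {i} → P i → ∃[ a ] index a ≡ i

  index-cancel-< : ∀ {a b} → index a < index b → a < b
  index-cancel-< {a} {b} ia<ib with <-cmp a b
  ... | tri< a<b _ _ = a<b
  ... | tri≈ _ refl _ = contradiction ia<ib (<-irrefl refl)
  ... | tri> _ _ b<a = contradiction ia<ib (<-asym (index-mono-< b<a))

  index-injective : Injective _≡_ _≡_ index
  index-injective {a} {b} ia≡ib with <-cmp a b
  ... | tri< a<b _ _ = contradiction ia≡ib (<⇒≢ (index-mono-< a<b))
  ... | tri≈ _ a≡b _ = a≡b
  ... | tri> _ _ b<a = contradiction (sym ia≡ib) (<⇒≢ (index-mono-< b<a))

module _ {t : ℕ} {P : Fin (suc t) → Set} (E : Enumeration (P ∘ suc)) where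

  open Enumeration E

  enumeration-skip : ¬ P zero → Enumeration P
  enumeration-skip ¬P0 = record
    { size         = size
    ; index        = suc ∘ index
    ; index-mono-< = λ a<b → s≤s (index-mono-< a<b)
    ; index-∈      = index-∈
    ; index-onto   = λ { {zero} P0 → contradiction P0 ¬P0
                       ; {suc i} Pi → Product.map₂ (cong suc) (index-onto Pi) }
    }

  enumeration-cons : P zero → Enumeration P
  enumeration-cons P0 = record
    { size         = suc size
    ; index        = index′
    ; index-mono-< = mono
    ; index-∈      = λ { zero → P0 ; (suc a) → index-∈ a }
    ; index-onto   = λ { {zero} _ → zero , refl
                       ; {suc i} Pi → Product.map suc (cong suc) (index-onto Pi) }
    }
    where
    index′ : Fin (suc size) → Fin (suc t)
    index′ zero    = zero
    index′ (suc a) = suc (index a)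

    mono : ∀ {a b} → a < b → index′ a < index′ b
    mono {zero}  {suc b} _         = s≤s z≤n
    mono {suc a} {suc b} (s≤s a<b) = s≤s (index-mono-< a<b)

enumerate : {t : ℕ} {P : Fin t → Set} → Decidable P → Enumeration P
enumerate {zero} P? = record
  { size = 0 ; index = λ () ; index-mono-< = λ { {()} } ; index-∈ = λ () ; index-onto = λ { {()} } }
enumerate {suc t} P? with P? zero
... | yes P0 = enumeration-cons (enumerate (P? ∘ suc)) P0
... | no ¬P0 = enumeration-skip (enumerate (P? ∘ suc)) ¬P0

shellable-empty : {C : Complex n} → (∀ F → ¬ IsFacet C F) → StronglyShellable C
shellable-empty no-facet =
  0 , (λ ()) , (λ { {()} }) , (λ ()) , (λ F F-facet → contradiction F-facet (no-facet F)) , λ ()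

-- A complex is an arbitrary predicate, so a facet can only be found up to double negation.
¬¬-facet : {C : Complex n} → C ⊥ → ¬ ¬ ∃ (IsFacet C)
¬¬-facet {n} {C} ⊥∈C no-facet = no-face-of-codim-≤ n ⊥ (m≤n+m n ∣ ⊥ {n} ∣) ⊥∈C
  where
  facet-unless-⊂ : ∀ {F} → C F → (∀ G → C G → ¬ F ⊂ G) → IsFacet C F
  facet-unless-⊂ {F} F∈C no-larger = F∈C , maximal
    where
    maximal : ∀ G → C G → F ⊆ G → G ≡ F
    maximal G G∈C F⊆G with F ⊂? G
    ... | yes F⊂G = ⊥-elim (no-larger G G∈C F⊂G)
    ... | no  F⊄G = ⊆-antisym G⊆F F⊆G
      where
      G⊆F : G ⊆ F
      G⊆F {x} x∈G with x ∈? F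
      ... | yes x∈F = x∈F
      ... | no  x∉F = ⊥-elim (F⊄G (F⊆G , x , x∈G , x∉F))

  no-face-of-codim-≤ : ∀ k F → n ≤ ∣ F ∣ + k → ¬ C F
  no-face-of-codim-≤ zero F n≤∣F∣+0 F∈C = no-facet (F , facet-unless-⊂ F∈C λ G _ F⊂G →
    <⇒≱ (≤-trans (p⊂q⇒∣p∣<∣q∣ F⊂G) (∣p∣≤n G)) (subst (n ≤_) (+-identityʳ ∣ F ∣) n≤∣F∣+0))
  no-face-of-codim-≤ (suc k) F n≤∣F∣+1+k F∈C = no-facet (F , facet-unless-⊂ F∈C λ G G∈C F⊂G →
    no-face-of-codim-≤ k G
      (≤-trans n≤∣F∣+1+k (≤-trans (≤-reflexive (+-suc ∣ F ∣ k)) (+-monoˡ-≤ k (p⊂q⇒∣p∣<∣q∣ F⊂G))))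
      G∈C)

module _ {Γ : Complex m} {Δ : Complex n} where

  shellable-fiberˡ : ∀ {G₀ σ} → IsFacet Δ G₀ → IsShellingOrder (FacetPair Γ Δ) PairStep t σ →
                     StronglyShellable Γ
  shellable-fiberˡ {t} {G₀} {σ} G₀-facet (σ-injective , σ-facet , σ-onto , σ-step) =
    size , τ , τ-injective , τ-facet , τ-onto , τ-step
    where
    open Enumeration (enumerate {P = λ i → proj₂ (σ i) ≡ G₀} (λ i → ≡-dec Bool._≟_ (proj₂ (σ i)) G₀))

    τ : Fin size → Subset m
    τ a = proj₁ (σ (index a))

    τ-injective : Injective _≡_ _≡_ τ
    τ-injective {a} {b} τa≡τb =
      index-injective (σ-injective (cong₂ _,_ τa≡τb (trans (index-∈ a) (sym (index-∈ b)))))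

    τ-facet : ∀ a → IsFacet Γ (τ a)
    τ-facet a = proj₁ (σ-facet (index a))

    τ-onto : ∀ F → IsFacet Γ F → ∃[ a ] τ a ≡ F
    τ-onto F F-facet with σ-onto (F , G₀) (F-facet , G₀-facet)
    ... | i , σi≡FG₀ with index-onto (cong proj₂ σi≡FG₀)
    ... | a , refl = a , cong proj₁ σi≡FG₀

    τ-step : ∀ a b → a < b → ∃[ c ] (c < b × StrongShellingStep (τ a) (τ b) (τ c))
    τ-step a b a<b with σ-step (index a) (index b) (index-mono-< a<b)
    ... | k , k<ib , step with pairStep-fiber (index-∈ a) (index-∈ b) step
    ... | σk-in-fiber , τ-step-k with index-onto σk-in-fiber
    ... | c , refl = c , index-cancel-< k<ib , τ-step-k

  shellable-projˡ : Δ ⊥ → Shellable (FacetPair Γ Δ) PairStep → StronglyShellable Γ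
  shellable-projˡ ⊥∈Δ (zero , σ , _ , _ , σ-onto , _) =
    shellable-empty λ F F-facet → ¬¬-facet ⊥∈Δ λ (G , G-facet) →
      ¬Fin0 (proj₁ (σ-onto (F , G) (F-facet , G-facet)))
  shellable-projˡ _ (suc t , σ , order@(_ , σ-facet , _)) = shellable-fiberˡ (proj₂ (σ-facet zero)) order

combine-monoʳ-< : ∀ {s r} (i : Fin s) {j d : Fin r} → j < d → combine i j < combine i d
combine-monoʳ-< {r = r} i {j} {d} j<d =
  subst₂ ℕ._<_ (sym (toℕ-combine i j)) (sym (toℕ-combine i d)) (+-monoʳ-< (r * toℕ i) j<d)

combine-<-lex : ∀ {s r} {i c : Fin s} {j d : Fin r} → combine i j < combine c d → i < c ⊎ (i ≡ c × j < d)
combine-<-lex {r = r} {i} {c} {j} {d} ij<cd with <-cmp i c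
... | tri< i<c _ _ = inj₁ i<c
... | tri≈ _ refl _ = inj₂ (refl ,
  +-cancelˡ-< (r * toℕ i) (toℕ j) (toℕ d) (subst₂ ℕ._<_ (toℕ-combine i j) (toℕ-combine i d) ij<cd))
... | tri> _ _ c<i = contradiction ij<cd (<-asym (combine-monoˡ-< d j c<i))

module _ {Γ : Complex m} {Δ : Complex n} where

  shellable-pairs : StronglyShellable Γ → StronglyShellable Δ → Shellable (FacetPair Γ Δ) PairStep
  shellable-pairs (s , σ₁ , σ₁-injective , σ₁-facet , σ₁-onto , σ₁-step)
                  (r , σ₂ , σ₂-injective , σ₂-facet , σ₂-onto , σ₂-step) =
    s * r , τ , τ-injective , τ-facet , τ-onto , τ-step
    where
    τ : Fin (s * r) → Subset m × Subset n
    τ = Product.map σ₁ σ₂ ∘ remQuot r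

    τ-combine : ∀ i j → τ (combine i j) ≡ (σ₁ i , σ₂ j)
    τ-combine i j = cong (Product.map σ₁ σ₂) (remQuot-combine i j)

    τ-injective : Injective _≡_ _≡_ τ
    τ-injective τa≡τb = Injection.injective (Inverse⇒Injection (*↔× {s} {r}))
      (cong₂ _,_ (σ₁-injective (cong proj₁ τa≡τb)) (σ₂-injective (cong proj₂ τa≡τb)))

    τ-facet : ∀ a → FacetPair Γ Δ (τ a)
    τ-facet a = σ₁-facet _ , σ₂-facet _

    τ-onto : ∀ FG → FacetPair Γ Δ FG → ∃[ a ] τ a ≡ FG
    τ-onto (F , G) (F-facet , G-facet) with σ₁-onto F F-facet | σ₂-onto G G-facet
    ... | i , refl | j , refl = combine i j , τ-combine i j

    lex-step : ∀ i j c d → combine i j < combine c d →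
               ∃[ k ] (k < combine c d × PairStep (σ₁ i , σ₂ j) (σ₁ c , σ₂ d) (τ k))
    lex-step i j c d ij<cd with combine-<-lex ij<cd
    ... | inj₁ i<c =
      let k , k<c , step = σ₁-step i c i<c
      in combine k d , combine-monoˡ-< d d k<c ,
         subst (PairStep _ _) (sym (τ-combine k d)) (pairStep-left (σ₂ j) (σ₂ d) step)
    ... | inj₂ (refl , j<d) =
      let k , k<d , step = σ₂-step j d j<d
      in combine i k , combine-monoʳ-< i k<d ,
         subst (PairStep _ _) (sym (τ-combine i k)) (pairStep-right (σ₁ i) (σ₁ i) step)

    τ-step : ∀ a b → a < b → ∃[ k ] (k < b × PairStep (τ a) (τ b) (τ k))
    τ-step a b a<b
      with i , j , refl ← combine-surjective {s} {r} a | c , d , refl ← combine-surjective {s} {r} b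
      = subst₂ (λ x y → ∃[ k ] (k < b × PairStep x y (τ k))) (sym (τ-combine i j)) (sym (τ-combine c d))
          (lex-step i j c d a<b)

proposition2p16 : (m n : ℕ) (Γ : Complex m) (Δ : Complex n) →
    IsSimplicialComplex Γ → IsSimplicialComplex Δ →
    StronglyShellable (Join Γ Δ) ⇔ (StronglyShellable Γ × StronglyShellable Δ)
proposition2p16 m n Γ Δ (⊥∈Γ , _) (⊥∈Δ , _) = mk⇔
  (λ join-shellable →
     let pairs-shellable = Equivalence.from shellable-join join-shellable
     in shellable-projˡ ⊥∈Δ pairs-shellable , shellable-projˡ ⊥∈Γ (shellable-swap pairs-shellable))
  (λ (Γ-shellable , Δ-shellable) → Equivalence.to shellable-join (shellable-pairs Γ-shellable Δ-shellable))
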